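{- Let $d\in\mathcal{D}_\Box$ and $\delta_L,\delta_R\in\mathcal{D}_\Box^*$, and consider the transition system $\mathcal{T}_E$ induced by the recursive specification $E=E_T\cup E_Q^\infty$. (i) If $\delta_R=d_R\zeta_R$ for some $\zeta_R\in\mathcal{D}_\Box^*$ and $d_R\in\mathcal{D}_\Box$, then there is a deterministic internal computation from $[H^R_d\parallel Q_{\delta_R\bot\delta_L}]_{\{i,o\}}$ to $[H_{d_R}\parallel Q_{\zeta_R\bot\delta_Ld}]_{\{i,o\}}$. (ii) If $\delta_R=\varepsilon$ (the empty string), then there is a deterministic internal computation from $[H^R_d\parallel Q_{\delta_R\bot\delta_L}]_{\{i,o\}}$ to $[H_\Box\parallel Q_{\bot\delta_Ld}]_{\{i,o\}}$.
   Context: Process calculus. Fix a finite set $\mathcal{A}$ of actions, $\tau\notin\mathcal{A}$, $\mathcal{A}_\tau=\mathcal{A}\cup\{\tau\}$, a finite data set $\mathcal{D}$ with blank $\Box\notin\mathcal{D}$, $\mathcal{D}_\Box=\mathcal{D}\cup\{\Box\}$, two extra symbols $\bot,\$\notin\mathcal{D}_\Box$, and a finite set of channels (including $i,o$). For a set $C'$ of channels, $I_{C'}=\{c?v,c!v\mid c\in C'\}$ where $v$ ranges over the communicated values ($c?v$: receive $v$ on $c$; $c!v$: send $v$ on $c$). Process expressions: $p::=0\mid 1\mid a.p\mid p+p\mid[p\parallel p]_{C'}\mid X$ with $a$ an action or communication action, $X$ a name. A recursive specification $E$ is a set of equations $X\stackrel{def}{=}p$, at most one per name, with a defining equation for every name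 occurring in a right-hand side. Operational rules (write $p\downarrow$ for termination): $1\downarrow$; $a.p\xrightarrow{a}p$; $p+q$ has the transitions of $p$ and of $q$ and terminates if $p$ or $q$ does; $[p\parallel q]_{C'}\xrightarrow{a}[p'\parallel q]_{C'}$ if $p\xrightarrow{a}p'$ and $a\notin I_{C'}$, and symmetrically for $q$; $[p\parallel q]_{C'}\xrightarrow{\tau}[p'\parallel q']_{C'}$ if for some $c\in C'$ and value $v$, $p\xrightarrow{c?v}p'$ and $q\xrightarrow{c!v}q'$ or vice versa; $[p\parallel q]_{C'}\downarrow$ if $p\downarrow$ and $q\downarrow$; $X\xrightarrow{a}p'$ (resp. $X\downarrow$) if $(X\stackrel{def}{=}p)\in E$ and $p\xrightarrow{a}p'$ (resp. $p\downarrow$). $\mathcal{T}_E(p)$ is the transition system of expressions reachable from $p$, initial state $p$, final states those $q$ with $q\downarrow$. A deterministic internal computation from $p$ to $p'$ is a sequence $p=s_1\xrightarrow{\tau}s_2\xrightarrow{\tau}\cdots\xrightarrow{\tau}s_n=p'$ such that for every $j<n$, $s_j\xrightarrow{a}s'$ implies $a=\tau$ and $s'=s_{j+1}$. Queue $E_Q^\infty$ (over $\Delta=\mathcal{D}_\Box\cup\{\bot,\$\}$): $Q_\varepsilon\stackrel{def}{=}\sum_{x\in\Delta}i?x.Q_x+1$ and, for $\sigma\in\Delta^*$, $x\in\Delta$: $Q_{\sigma x}\stackrel{def}{=}o!x.Q_\sigma+\sum_{y\in\Delta}i?y.Q_{y\sigma x}+1$. Tape controller $E_T$: for $d\in\mathcal{D}_\Box$,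 $H_d\stackrel{def}{=}r!d.H_d+\sum_{e\in\mathcal{D}_\Box}w?e.H_e+m?L.H^L_d+m?R.H^R_d+1$; $H^L_d\stackrel{def}{=}i!d.\big(\sum_{e\in\mathcal{D}_\Box}o?e.H_e+o?\bot.i!\$.i!\bot.\mathit{Back}\big)$; $\mathit{Back}\stackrel{def}{=}\sum_{e\in\mathcal{D}_\Box}o?e.i!e.\mathit{Back}+o?\$.H_\Box$; $H^R_d\stackrel{def}{=}i!\$.i!d.\big(\sum_{e\in\mathcal{D}_\Box}o?e.\mathit{Fwd}_e+o?\bot.\mathit{Fwd}_\bot\big)$; $\mathit{Fwd}_d\stackrel{def}{=}\sum_{e\in\mathcal{D}_\Box}o?e.i!d.\mathit{Fwd}_e+o?\bot.i!d.\mathit{Fwd}_\bot+o?\$.H_d$; $\mathit{Fwd}_\bot\stackrel{def}{=}\sum_{e\in\mathcal{D}_\Box}o?e.i!\bot.\mathit{Fwd}_e+o?\$.i!\bot.H_\Box$. -}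

module Defs where

open import Data.List using (List; []; _∷_; _++_; map; foldr; unsnoc)
open import Data.List.Membership.Propositional using (_∈_)
open import Data.Maybe using (just; nothing)
open import Data.Product using (_×_; _,_)
open import Data.Empty using (⊥)
open import Relation.Nullary using (¬_)
open import Relation.Binary.PropositionalEquality using (_≡_)

data D□ (D : Set) : Set where
  □    : D□ D
  dat  : D → D□ D

data Δ (D : Set) : Set where
  ⌜_⌝  : D□ D → Δ D
  ⊥ₛ   : Δ D
  $ₛ   : Δ D

-- communicated values: elements of Δ, and the head-move directions L, R (channel m)
data Val (D : Set) : Set where
  val  : Δ D → Val D
  Lv   : Val D
  Rv   : Val D

-- channels (i, o of the queue; r, w, m of the tape controller)
data Chan : Set where
  i o r w m : Chan

data Label (A D : Set) : Set where
  act   : A → Label A D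
  τ     : Label A D
  _⁇_   : Chan → Val D → Label A D
  _‼_   : Chan → Val D → Label A D

data Name (D : Set) : Set where
  Q      : List (Δ D) → Name D
  H      : D□ D → Name D
  HL     : D□ D → Name D
  HR     : D□ D → Name D
  Back   : Name D
  Fwd    : D□ D → Name D
  Fwd⊥   : Name D

data Proc (A D : Set) : Set where
  𝟘     : Proc A D
  𝟙     : Proc A D
  _∙_   : Label A D → Proc A D → Proc A D
  _⊕_   : Proc A D → Proc A D → Proc A D
  [_∥_]_ : Proc A D → Proc A D → List Chan → Proc A D
  var   : Name D → Proc A D

infixr 20 _∙_
infixr 10 _⊕_

enumD□ : {D : Set} → List D → List (D□ D)
enumD□ enumD = □ ∷ map dat enumD

enumΔ : {D : Set} → List D → List (Δ D)
enumΔ enumD = ⊥ₛ ∷ $ₛ ∷ map ⌜_⌝ (enumD□ enumD)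

∑ : {A D X : Set} → List X → (X → Proc A D) → Proc A D
∑ xs f = foldr (λ x p → f x ⊕ p) 𝟘 xs

module _ {A D : Set} (enumD : List D) where

  private
    P = Proc A D
    v : D□ D → Val D
    v e = val ⌜ e ⌝
    ∑D□ : (D□ D → P) → P
    ∑D□ = ∑ (enumD□ enumD)
    ∑Δ : (Δ D → P) → P
    ∑Δ = ∑ (enumΔ enumD)

  defE : Name D → P
  defE (Q σ) with unsnoc σ
  ... | nothing       = ∑Δ (λ x → (i ⁇ val x) ∙ var (Q (x ∷ []))) ⊕ 𝟙
  ... | just (σ′ , x) = ((o ‼ val x) ∙ var (Q σ′))
                         ⊕ (∑Δ (λ y → (i ⁇ val y) ∙ var (Q (y ∷ σ′ ++ x ∷ [])))
                         ⊕ 𝟙)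
  defE (H d) = ((r ‼ v d) ∙ var (H d))
               ⊕ (∑D□ (λ e → (w ⁇ v e) ∙ var (H e))
               ⊕ (((m ⁇ Lv) ∙ var (HL d))
               ⊕ (((m ⁇ Rv) ∙ var (HR d))
               ⊕ 𝟙)))
  defE (HL d) = (i ‼ v d) ∙ (∑D□ (λ e → (o ⁇ v e) ∙ var (H e))
                 ⊕ ((o ⁇ val ⊥ₛ) ∙ (i ‼ val $ₛ) ∙ (i ‼ val ⊥ₛ) ∙ var Back))
  defE Back = ∑D□ (λ e → (o ⁇ v e) ∙ (i ‼ v e) ∙ var Back)
              ⊕ ((o ⁇ val $ₛ) ∙ var (H □))
  defE (HR d) = (i ‼ val $ₛ) ∙ (i ‼ v d) ∙
                 (∑D□ (λ e → (o ⁇ v e) ∙ var (Fwd e))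
                  ⊕ ((o ⁇ val ⊥ₛ) ∙ var Fwd⊥))
  defE (Fwd d) = ∑D□ (λ e → (o ⁇ v e) ∙ (i ‼ v d) ∙ var (Fwd e))
                 ⊕ (((o ⁇ val ⊥ₛ) ∙ (i ‼ v d) ∙ var Fwd⊥)
                 ⊕ ((o ⁇ val $ₛ) ∙ var (H d)))
  defE Fwd⊥ = ∑D□ (λ e → (o ⁇ v e) ∙ (i ‼ val ⊥ₛ) ∙ var (Fwd e))
              ⊕ ((o ⁇ val $ₛ) ∙ (i ‼ val ⊥ₛ) ∙ var (H □))

  InI : List Chan → Label A D → Set
  InI C (c ⁇ _) = c ∈ C
  InI C (c ‼ _) = c ∈ C
  InI C _       = ⊥

  data _↓ : P → Set where
    1↓   : 𝟙 ↓
    +↓ˡ  : ∀ {p q} → p ↓ → (p ⊕ q) ↓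
    +↓ʳ  : ∀ {p q} → q ↓ → (p ⊕ q) ↓
    ∥↓   : ∀ {p q C} → p ↓ → q ↓ → ([ p ∥ q ] C) ↓
    var↓ : ∀ {X} → defE X ↓ → var X ↓

  data _⟶[_]_ : P → Label A D → P → Set where
    pre  : ∀ {a p} → (a ∙ p) ⟶[ a ] p
    +ˡ   : ∀ {p q a p′} → p ⟶[ a ] p′ → (p ⊕ q) ⟶[ a ] p′
    +ʳ   : ∀ {p q a q′} → q ⟶[ a ] q′ → (p ⊕ q) ⟶[ a ] q′
    ∥ˡ   : ∀ {p q a p′ C} → p ⟶[ a ] p′ → ¬ InI C a →
           ([ p ∥ q ] C) ⟶[ a ] ([ p′ ∥ q ] C)
    ∥ʳ   : ∀ {p q a q′ C} → q ⟶[ a ] q′ → ¬ InI C a →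
           ([ p ∥ q ] C) ⟶[ a ] ([ p ∥ q′ ] C)
    comm?! : ∀ {p q p′ q′ C c x} → c ∈ C → p ⟶[ c ⁇ x ] p′ → q ⟶[ c ‼ x ] q′ →
             ([ p ∥ q ] C) ⟶[ τ ] ([ p′ ∥ q′ ] C)
    comm!? : ∀ {p q p′ q′ C c x} → c ∈ C → p ⟶[ c ‼ x ] p′ → q ⟶[ c ⁇ x ] q′ →
             ([ p ∥ q ] C) ⟶[ τ ] ([ p′ ∥ q′ ] C)
    var⟶ : ∀ {X a p′} → defE X ⟶[ a ] p′ → var X ⟶[ a ] p′

  data DetInt : P → P → Set where
    done : ∀ {p} → DetInt p p
    step : ∀ {p s p′} → p ⟶[ τ ] s →
           (∀ {a s′} → p ⟶[ a ] s′ → (a ≡ τ) × (s′ ≡ s)) →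
           DetInt s p′ → DetInt p p′

-- a finite data set: a list containing every element
Complete : {D : Set} → List D → Set
Complete {D} enumD = (x : D) → x ∈ enumD

⟦_⊥_⟧ : {D : Set} → List (D□ D) → List (D□ D) → List (Δ D)
⟦ δR ⊥ δL ⟧ = map ⌜_⌝ δR ++ ⊥ₛ ∷ map ⌜_⌝ δL

module Submission where

-- After H^R_d has written $ and d into the queue, the tape
-- controller acts as a one-place delay line: it holds at most one symbol,
-- reads the next symbol at the output end of the queue (o?) and writes the
-- symbol it was holding back into the queue (i!).  Reading the content
-- δ_R ⊥ δ_L in this way rotates it by one place, and the final $ stops the
-- rotation, leaving the last symbol read in the head.  Every single step is a
-- deterministic τ-handshake: the controller offers either one output on i or
-- only inputs on o, and the queue can emit only its last symbol.

open import Defs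
open import Data.List using (List; []; _∷_; _++_; map; _∷ʳ_; InitLast; initLast; _∷ʳ′_; unsnoc)
open import Data.List.Properties using (++-assoc; map-++; ∷ʳ-++; ∷ʳ-injective)
open import Data.List.Relation.Unary.Any using (here; there)
open import Data.List.Membership.Propositional using (_∈_)
open import Data.List.Membership.Propositional.Properties using (∈-map⁺)
open import Data.Maybe using (just)
open import Data.Product using (_×_; _,_; Σ)
open import Data.Empty using (⊥-elim)
open import Relation.Binary.Bundles using (Preorder)
open import Relation.Binary.PropositionalEquality
  using (_≡_; refl; sym; trans; cong; subst; isEquivalence)

-- The queue is defined by case analysis on 'unsnoc'; these compute it on a
-- list presented as xs ∷ʳ x.
initLast-∷ʳ : {X : Set} (xs : List X) (x : X) → initLast (xs ∷ʳ x) ≡ (xs ∷ʳ′ x)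
initLast-∷ʳ []       x = refl
initLast-∷ʳ (y ∷ ys) x rewrite initLast-∷ʳ ys x = refl

unsnoc-∷ʳ : {X : Set} (xs : List X) (x : X) → unsnoc (xs ∷ʳ x) ≡ just (xs , x)
unsnoc-∷ʳ xs x rewrite initLast-∷ʳ xs x = refl

module TapeMachine {A D : Set} (enumD : List D) (complete : Complete enumD) where

  P : Set
  P = Proc A D

  _⟶⟨_⟩_ : P → Label A D → P → Set
  p ⟶⟨ a ⟩ q = _⟶[_]_ enumD p a q

  io : List Chan
  io = i ∷ o ∷ []

  ⟨_∣_⟩ : P → List (Δ D) → P
  ⟨ t ∣ σ ⟩ = [ t ∥ var (Q σ) ] io

  ∑-inv : {X : Set} (xs : List X) (f : X → P) {a : Label A D} {p : P} →
          ∑ xs f ⟶⟨ a ⟩ p → Σ X (λ x → f x ⟶⟨ a ⟩ p)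
  ∑-inv (x ∷ xs) f (+ˡ s) = x , s
  ∑-inv (x ∷ xs) f (+ʳ s) = ∑-inv xs f s

  ∑-intro : {X : Set} {xs : List X} (f : X → P) {x : X} {a : Label A D} {p : P} →
            x ∈ xs → f x ⟶⟨ a ⟩ p → ∑ xs f ⟶⟨ a ⟩ p
  ∑-intro f (here refl) s = +ˡ s
  ∑-intro f (there x∈xs) s = +ʳ (∑-intro f x∈xs s)

  -- the enumerations of 𝒟_□ and Δ are complete, so sums over them offer
  -- every summand
  D□-complete : (e : D□ D) → e ∈ enumD□ enumD
  D□-complete □       = here refl
  D□-complete (dat x) = there (∈-map⁺ dat (complete x))

  Δ-complete : (y : Δ D) → y ∈ enumΔ enumD
  Δ-complete ⊥ₛ    = here refl
  Δ-complete $ₛ    = there (here refl)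
  Δ-complete ⌜ e ⌝ = there (there (∈-map⁺ ⌜_⌝ (D□-complete e)))

  queue-inputs : List (Δ D) → P
  queue-inputs σ = ∑ (enumΔ enumD) (λ y → (i ⁇ val y) ∙ var (Q (y ∷ σ)))

  Q-unfold-∷ʳ : (σ : List (Δ D)) (x : Δ D) →
    defE {A} enumD (Q (σ ∷ʳ x)) ≡ ((o ‼ val x) ∙ var (Q σ)) ⊕ (queue-inputs (σ ∷ʳ x) ⊕ 𝟙)
  Q-unfold-∷ʳ σ x rewrite unsnoc-∷ʳ σ x = refl

  data QueueStep (σ : List (Δ D)) : Label A D → P → Set where
    input  : (y : Δ D) → QueueStep σ (i ⁇ val y) (var (Q (y ∷ σ)))
    output : (σ′ : List (Δ D)) (y : Δ D) → σ ≡ σ′ ∷ʳ y → QueueStep σ (o ‼ val y) (var (Q σ′))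

  queue-step : ∀ {σ a q} → var (Q σ) ⟶⟨ a ⟩ q → QueueStep σ a q
  queue-step {σ} (var⟶ s) = classify σ (initLast σ) s
    where
    classify : ∀ {a q} σ → InitLast σ → defE enumD (Q σ) ⟶⟨ a ⟩ q → QueueStep σ a q
    classify .[] [] (+ˡ s) with ∑-inv (enumΔ enumD) (λ y → (i ⁇ val y) ∙ var (Q (y ∷ []))) s
    ... | y , pre = input y
    classify .(σ ∷ʳ x) (σ ∷ʳ′ x) s with subst (λ p → p ⟶⟨ _ ⟩ _) (Q-unfold-∷ʳ σ x) s
    ... | +ˡ pre = output σ x refl
    ... | +ʳ (+ˡ s′) with ∑-inv (enumΔ enumD) (λ y → (i ⁇ val y) ∙ var (Q (y ∷ σ ∷ʳ x))) s′
    ...   | y , pre = input y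

  queue-io : ∀ {σ a q} → var (Q σ) ⟶⟨ a ⟩ q → InI enumD io a
  queue-io s with queue-step s
  ... | input _      = here refl
  ... | output _ _ _ = there (here refl)

  queue-input : (σ : List (Δ D)) (y : Δ D) → var (Q σ) ⟶⟨ i ⁇ val y ⟩ var (Q (y ∷ σ))
  queue-input σ y = var⟶ (accept σ (initLast σ))
    where
    accept : ∀ σ → InitLast σ → defE enumD (Q σ) ⟶⟨ i ⁇ val y ⟩ var (Q (y ∷ σ))
    accept .[] [] = +ˡ (∑-intro _ (Δ-complete y) pre)
    accept .(σ ∷ʳ x) (σ ∷ʳ′ x) =
      subst (λ p → p ⟶⟨ _ ⟩ _) (sym (Q-unfold-∷ʳ σ x)) (+ʳ (+ˡ (∑-intro _ (Δ-complete y) pre)))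

  queue-output : (σ : List (Δ D)) (x : Δ D) → var (Q (σ ∷ʳ x)) ⟶⟨ o ‼ val x ⟩ var (Q σ)
  queue-output σ x = var⟶ (subst (λ p → p ⟶⟨ _ ⟩ _) (sym (Q-unfold-∷ʳ σ x)) (+ˡ pre))

  _⇝_ : P → P → Set
  _⇝_ = DetInt {A} enumD

  ⇝-trans : ∀ {p q r} → p ⇝ q → q ⇝ r → p ⇝ r
  ⇝-trans done           qr = qr
  ⇝-trans (step s u pq)  qr = step s u (⇝-trans pq qr)

  ⇝-preorder : Preorder _ _ _
  ⇝-preorder = record
    { Carrier    = P
    ; _≈_        = _≡_
    ; _≲_        = _⇝_
    ; isPreorder = record
      { isEquivalence = isEquivalence
      ; reflexive     = λ { refl → done }
      ; trans         = ⇝-trans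
      }
    }

  open import Relation.Binary.Reasoning.Preorder ⇝-preorder
    using (begin_; step-≲; step-≡-⟩; _∎)

  Writes : P → Δ D → P → Set
  Writes t y t′ = (t ⟶⟨ i ‼ val y ⟩ t′) × (∀ {a s} → t ⟶⟨ a ⟩ s → (a ≡ i ‼ val y) × (s ≡ t′))

  ReadsOnly : P → (Δ D → P) → Set
  ReadsOnly t k = ∀ {a s} → t ⟶⟨ a ⟩ s → Σ (Δ D) (λ z → (a ≡ o ⁇ val z) × (s ≡ k z))

  write-step : ∀ {t y t′} σ → Writes t y t′ → ⟨ t ∣ σ ⟩ ⇝ ⟨ t′ ∣ y ∷ σ ⟩
  write-step {t} {y} {t′} σ (offers , only) =
    step (comm!? (here refl) offers (queue-input σ y)) unique done
    where
    unique : ∀ {a s} → ⟨ t ∣ σ ⟩ ⟶⟨ a ⟩ s → (a ≡ τ) × (s ≡ ⟨ t′ ∣ y ∷ σ ⟩)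
    unique (∥ˡ s notI) with only s
    ... | refl , _ = ⊥-elim (notI (here refl))
    unique (∥ʳ s notI) = ⊥-elim (notI (queue-io s))
    unique (comm?! _ s _) with only s
    ... | () , _
    unique (comm!? _ s s′) with only s | queue-step s′
    ... | refl , refl | input .y = refl , refl

  read-step : ∀ {t k} σ x → ReadsOnly t k → t ⟶⟨ o ⁇ val x ⟩ k x →
              ⟨ t ∣ σ ∷ʳ x ⟩ ⇝ ⟨ k x ∣ σ ⟩
  read-step {t} {k} σ x only reads =
    step (comm?! (there (here refl)) reads (queue-output σ x)) unique done
    where
    unique : ∀ {a s} → ⟨ t ∣ σ ∷ʳ x ⟩ ⟶⟨ a ⟩ s → (a ≡ τ) × (s ≡ ⟨ k x ∣ σ ⟩)
    unique (∥ˡ s notI) with only s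
    ... | _ , refl , _ = ⊥-elim (notI (there (here refl)))
    unique (∥ʳ s notI) = ⊥-elim (notI (queue-io s))
    unique (comm?! _ s s′) with only s | queue-step s′
    ... | _ , refl , refl | output σ′ _ eq with ∷ʳ-injective σ σ′ eq
    ...   | refl , refl = refl , refl
    unique (comm!? _ s _) with only s
    ... | _ , () , _

  -- a sequence of outputs: 'writes ys p' writes the symbols of ys into the
  -- queue, the last one first, and then continues as p
  writes : List (Δ D) → P → P
  writes []       p = p
  writes (y ∷ ys) p = writes ys ((i ‼ val y) ∙ p)

  prefix-writes : ∀ {y t} → Writes ((i ‼ val y) ∙ t) y t
  prefix-writes = pre , λ { pre → refl , refl }

  write-all : ∀ ys p σ → ⟨ writes ys p ∣ σ ⟩ ⇝ ⟨ p ∣ ys ++ σ ⟩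
  write-all []       p σ = done
  write-all (y ∷ ys) p σ = ⇝-trans (write-all ys ((i ‼ val y) ∙ p) σ) (write-step (ys ++ σ) prefix-writes)

  -- what the controller holds while forwarding: nothing yet (right after
  -- H^R_d), a datum e (state Fwd_e), or the end marker ⊥ (state Fwd_⊥)
  data Held : Set where
    nothing-held : Held
    datum        : D□ D → Held
    bottom       : Held

  released : Held → List (Δ D)
  released nothing-held = []
  released (datum e)    = ⌜ e ⌝ ∷ []
  released bottom       = ⊥ₛ ∷ []

  -- the reaction of the controller holding h to reading z;
  -- 𝟘 marks the symbols it does not accept
  react : Held → Δ D → P
  react h ⌜ e ⌝           = writes (released h) (var (Fwd e))
  react bottom ⊥ₛ         = 𝟘
  react h ⊥ₛ              = writes (released h) (var Fwd⊥)
  react nothing-held $ₛ   = 𝟘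
  react (datum e) $ₛ      = var (H e)
  react bottom $ₛ         = (i ‼ val ⊥ₛ) ∙ var (H □)

  datum-summand : Held → D□ D → P
  datum-summand h e = (o ⁇ val ⌜ e ⌝) ∙ react h ⌜ e ⌝

  -- the controller holding h: the residue of H^R_d after its two outputs,
  -- Fwd_e, or Fwd_⊥
  forward : Held → P
  forward nothing-held = ∑ (enumD□ enumD) (datum-summand nothing-held)
                         ⊕ ((o ⁇ val ⊥ₛ) ∙ var Fwd⊥)
  forward (datum e)    = var (Fwd e)
  forward bottom       = var Fwd⊥

  forward-reads-only : ∀ h → ReadsOnly (forward h) (react h)
  forward-reads-only nothing-held (+ˡ s) with ∑-inv (enumD□ enumD) (datum-summand nothing-held) s
  ... | e , pre = ⌜ e ⌝ , refl , refl
  forward-reads-only nothing-held (+ʳ pre) = ⊥ₛ , refl , refl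
  forward-reads-only (datum x) (var⟶ (+ˡ s)) with ∑-inv (enumD□ enumD) (datum-summand (datum x)) s
  ... | e , pre = ⌜ e ⌝ , refl , refl
  forward-reads-only (datum x) (var⟶ (+ʳ (+ˡ pre))) = ⊥ₛ , refl , refl
  forward-reads-only (datum x) (var⟶ (+ʳ (+ʳ pre))) = $ₛ , refl , refl
  forward-reads-only bottom (var⟶ (+ˡ s)) with ∑-inv (enumD□ enumD) (datum-summand bottom) s
  ... | e , pre = ⌜ e ⌝ , refl , refl
  forward-reads-only bottom (var⟶ (+ʳ pre)) = $ₛ , refl , refl

  forward-accepts : ∀ h e → forward h ⟶⟨ o ⁇ val ⌜ e ⌝ ⟩ react h ⌜ e ⌝
  forward-accepts nothing-held e = +ˡ (∑-intro (datum-summand nothing-held) (D□-complete e) pre)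
  forward-accepts (datum x) e = var⟶ (+ˡ (∑-intro (datum-summand (datum x)) (D□-complete e) pre))
  forward-accepts bottom e = var⟶ (+ˡ (∑-intro (datum-summand bottom) (D□-complete e) pre))

  read-datum : ∀ h e σ → ⟨ forward h ∣ σ ∷ʳ ⌜ e ⌝ ⟩ ⇝ ⟨ forward (datum e) ∣ released h ++ σ ⟩
  read-datum h e σ =
    ⇝-trans (read-step σ ⌜ e ⌝ (forward-reads-only h) (forward-accepts h e))
            (write-all (released h) (var (Fwd e)) σ)

  read-bottom-after-nothing : ∀ σ → ⟨ forward nothing-held ∣ σ ∷ʳ ⊥ₛ ⟩ ⇝ ⟨ forward bottom ∣ σ ⟩
  read-bottom-after-nothing σ = read-step σ ⊥ₛ (forward-reads-only nothing-held) (+ʳ pre)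

  read-bottom-after-datum : ∀ x σ → ⟨ forward (datum x) ∣ σ ∷ʳ ⊥ₛ ⟩ ⇝ ⟨ forward bottom ∣ ⌜ x ⌝ ∷ σ ⟩
  read-bottom-after-datum x σ =
    ⇝-trans (read-step σ ⊥ₛ (forward-reads-only (datum x)) (var⟶ (+ʳ (+ˡ pre))))
            (write-step σ prefix-writes)

  read-end-after-datum : ∀ x σ → ⟨ forward (datum x) ∣ σ ∷ʳ $ₛ ⟩ ⇝ ⟨ var (H x) ∣ σ ⟩
  read-end-after-datum x σ = read-step σ $ₛ (forward-reads-only (datum x)) (var⟶ (+ʳ (+ʳ pre)))

  read-end-after-bottom : ∀ σ → ⟨ forward bottom ∣ σ ∷ʳ $ₛ ⟩ ⇝ ⟨ var (H □) ∣ ⊥ₛ ∷ σ ⟩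
  read-end-after-bottom σ =
    ⇝-trans (read-step σ $ₛ (forward-reads-only bottom) (var⟶ (+ʳ pre)))
            (write-step σ prefix-writes)

  tape : List (D□ D) → List (Δ D)
  tape = map ⌜_⌝

  sweep-block : ∀ h y ys σ →
    ⟨ forward h ∣ σ ++ tape (y ∷ ys) ⟩ ⇝ ⟨ forward (datum y) ∣ tape ys ++ released h ++ σ ⟩
  sweep-block h y []        σ = read-datum h y σ
  sweep-block h y (y′ ∷ ys) σ = begin
    ⟨ forward h ∣ σ ++ tape (y ∷ y′ ∷ ys) ⟩
      ≡⟨ cong (⟨ forward h ∣_⟩) (sym (∷ʳ-++ σ ⌜ y ⌝ (tape (y′ ∷ ys)))) ⟩
    ⟨ forward h ∣ (σ ∷ʳ ⌜ y ⌝) ++ tape (y′ ∷ ys) ⟩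
      ≲⟨ sweep-block h y′ ys (σ ∷ʳ ⌜ y ⌝) ⟩
    ⟨ forward (datum y′) ∣ tape ys ++ released h ++ σ ∷ʳ ⌜ y ⌝ ⟩
      ≡⟨ cong (⟨ forward (datum y′) ∣_⟩) (sym rebracket) ⟩
    ⟨ forward (datum y′) ∣ (tape ys ++ released h ++ σ) ∷ʳ ⌜ y ⌝ ⟩
      ≲⟨ read-datum (datum y′) y (tape ys ++ released h ++ σ) ⟩
    ⟨ forward (datum y) ∣ tape (y′ ∷ ys) ++ released h ++ σ ⟩ ∎
    where
    rebracket : (tape ys ++ released h ++ σ) ∷ʳ ⌜ y ⌝ ≡ tape ys ++ released h ++ σ ∷ʳ ⌜ y ⌝
    rebracket = trans (++-assoc (tape ys) (released h ++ σ) (⌜ y ⌝ ∷ []))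
                      (cong (tape ys ++_) (++-assoc (released h) σ (⌜ y ⌝ ∷ [])))

  sweep-left : ∀ δL σ → ⟨ forward nothing-held ∣ σ ++ ⊥ₛ ∷ tape δL ⟩ ⇝ ⟨ forward bottom ∣ tape δL ++ σ ⟩
  sweep-left []       σ = read-bottom-after-nothing σ
  sweep-left (y ∷ ys) σ = begin
    ⟨ forward nothing-held ∣ σ ++ ⊥ₛ ∷ tape (y ∷ ys) ⟩
      ≡⟨ cong (⟨ forward nothing-held ∣_⟩) (sym (∷ʳ-++ σ ⊥ₛ (tape (y ∷ ys)))) ⟩
    ⟨ forward nothing-held ∣ (σ ∷ʳ ⊥ₛ) ++ tape (y ∷ ys) ⟩
      ≲⟨ sweep-block nothing-held y ys (σ ∷ʳ ⊥ₛ) ⟩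
    ⟨ forward (datum y) ∣ tape ys ++ σ ∷ʳ ⊥ₛ ⟩
      ≡⟨ cong (⟨ forward (datum y) ∣_⟩) (sym (++-assoc (tape ys) σ (⊥ₛ ∷ []))) ⟩
    ⟨ forward (datum y) ∣ (tape ys ++ σ) ∷ʳ ⊥ₛ ⟩
      ≲⟨ read-bottom-after-datum y (tape ys ++ σ) ⟩
    ⟨ forward bottom ∣ tape (y ∷ ys) ++ σ ⟩ ∎

  move-right-to-δR : ∀ d δL δR →
    ⟨ var (HR d) ∣ ⟦ δR ⊥ δL ⟧ ⟩ ⇝ ⟨ forward bottom ∣ tape (δL ++ d ∷ []) ++ $ₛ ∷ tape δR ⟩
  move-right-to-δR d δL δR = begin
    ⟨ var (HR d) ∣ ⟦ δR ⊥ δL ⟧ ⟩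
      ≲⟨ write-step ⟦ δR ⊥ δL ⟧ (var⟶ pre , λ { (var⟶ pre) → refl , refl }) ⟩
    ⟨ writes (⌜ d ⌝ ∷ []) (forward nothing-held) ∣ $ₛ ∷ ⟦ δR ⊥ δL ⟧ ⟩
      ≲⟨ write-all (⌜ d ⌝ ∷ []) (forward nothing-held) ($ₛ ∷ ⟦ δR ⊥ δL ⟧) ⟩
    ⟨ forward nothing-held ∣ (⌜ d ⌝ ∷ $ₛ ∷ tape δR) ++ ⊥ₛ ∷ tape δL ⟩
      ≲⟨ sweep-left δL (⌜ d ⌝ ∷ $ₛ ∷ tape δR) ⟩
    ⟨ forward bottom ∣ tape δL ++ ⌜ d ⌝ ∷ $ₛ ∷ tape δR ⟩
      ≡⟨ cong (⟨ forward bottom ∣_⟩) (sym (trans (cong (_++ $ₛ ∷ tape δR) (map-++ ⌜_⌝ δL (d ∷ [])))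
                                                 (∷ʳ-++ (tape δL) ⌜ d ⌝ ($ₛ ∷ tape δR)))) ⟩
    ⟨ forward bottom ∣ tape (δL ++ d ∷ []) ++ $ₛ ∷ tape δR ⟩ ∎

  sweep-right : ∀ dR ζR σ →
    ⟨ forward bottom ∣ σ ++ $ₛ ∷ tape (dR ∷ ζR) ⟩ ⇝ ⟨ var (H dR) ∣ tape ζR ++ ⊥ₛ ∷ σ ⟩
  sweep-right dR ζR σ = begin
    ⟨ forward bottom ∣ σ ++ $ₛ ∷ tape (dR ∷ ζR) ⟩
      ≡⟨ cong (⟨ forward bottom ∣_⟩) (sym (∷ʳ-++ σ $ₛ (tape (dR ∷ ζR)))) ⟩
    ⟨ forward bottom ∣ (σ ∷ʳ $ₛ) ++ tape (dR ∷ ζR) ⟩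
      ≲⟨ sweep-block bottom dR ζR (σ ∷ʳ $ₛ) ⟩
    ⟨ forward (datum dR) ∣ tape ζR ++ ⊥ₛ ∷ σ ∷ʳ $ₛ ⟩
      ≡⟨ cong (⟨ forward (datum dR) ∣_⟩) (sym (++-assoc (tape ζR) (⊥ₛ ∷ σ) ($ₛ ∷ []))) ⟩
    ⟨ forward (datum dR) ∣ (tape ζR ++ ⊥ₛ ∷ σ) ∷ʳ $ₛ ⟩
      ≲⟨ read-end-after-datum dR (tape ζR ++ ⊥ₛ ∷ σ) ⟩
    ⟨ var (H dR) ∣ tape ζR ++ ⊥ₛ ∷ σ ⟩ ∎

lemma3 : (A D : Set) (enumD : List D) → Complete enumD →
    (d : D□ D) (δL δR : List (D□ D)) →
    ((dR : D□ D) (ζR : List (D□ D)) → δR ≡ dR ∷ ζR →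
      DetInt {A} enumD
        ([ var (HR d) ∥ var (Q ⟦ δR ⊥ δL ⟧) ] (i ∷ o ∷ []))
        ([ var (H dR) ∥ var (Q ⟦ ζR ⊥ (δL ++ d ∷ []) ⟧) ] (i ∷ o ∷ [])))
    ×
    (δR ≡ [] →
      DetInt {A} enumD
        ([ var (HR d) ∥ var (Q ⟦ δR ⊥ δL ⟧) ] (i ∷ o ∷ []))
        ([ var (H □) ∥ var (Q ⟦ [] ⊥ (δL ++ d ∷ []) ⟧) ] (i ∷ o ∷ [])))
lemma3 A D enumD complete d δL δR = nonempty-right , empty-right
  where
  open TapeMachine {A} enumD complete
  nonempty-right : (dR : D□ D) (ζR : List (D□ D)) → δR ≡ dR ∷ ζR →
    ⟨ var (HR d) ∣ ⟦ δR ⊥ δL ⟧ ⟩ ⇝ ⟨ var (H dR) ∣ ⟦ ζR ⊥ (δL ++ d ∷ []) ⟧ ⟩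
  nonempty-right dR ζR refl =
    ⇝-trans (move-right-to-δR d δL δR) (sweep-right dR ζR (tape (δL ++ d ∷ [])))
  empty-right : δR ≡ [] → ⟨ var (HR d) ∣ ⟦ δR ⊥ δL ⟧ ⟩ ⇝ ⟨ var (H □) ∣ ⟦ [] ⊥ (δL ++ d ∷ []) ⟧ ⟩
  empty-right refl =
    ⇝-trans (move-right-to-δR d δL []) (read-end-after-bottom (tape (δL ++ d ∷ [])))
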